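{- Let $n$ be a context, let $P,P'\in\mathrm{Proc}(n)$, let $a$ be an action in $n$, let $R\in\mathrm{Proc}(n+|a|)$ with $P\xrightarrow{a}R$, and suppose $P$ and $P'$ are related by a braiding, i.e. one of the following holds: (i) $n=\Gamma+2+\Delta$ for contexts $\Gamma,\Delta$ and $P\bowtie_\Delta P'$ (generalised free braid); (ii) $P\rtimes P'$ (generalised bound braid). Then there exist an action $a'$ in $n$ and a process $R'\in\mathrm{Proc}(n+|a|)$ such that $P'\xrightarrow{a'}R'$ and, in case (i), $R\bowtie_{\Delta+|a|}R'$, while in case (ii), $R\rtimes R'$.
   Context: Synchronous $\pi$-calculus with de Bruijn indices. Contexts $\Gamma$ are natural numbers; a name in $\Gamma$ is a natural number $x<\Gamma$. The set $\mathrm{Proc}(\Gamma)$ of processes closed by $\Gamma$ is defined inductively: $\mathbf{0}\in\mathrm{Proc}(\Gamma)$; if $x<\Gamma$ and $P\in\mathrm{Proc}(\Gamma+1)$ then $\mathsf{in}\,x.P\in\mathrm{Proc}(\Gamma)$ (input on $x$, binding index $0$ in $P$); if $x,y<\Gamma$ and $P\in\mathrm{Proc}(\Gamma)$ then $\overline{x}\langle y\rangle.P\in\mathrm{Proc}(\Gamma)$; if $P,Q\in\mathrm{Proc}(\Gamma)$ then $P+Q$ and $P\mid Q$ are in $\mathrm{Proc}(\Gamma)$; if $P\in\mathrm{Proc}(\Gamma+1)$ then $\nu P\in\mathrm{Proc}(\Gamma)$; if $P\in\mathrm{Proc}(\Gamma)$ then $!P\in\mathrm{Proc}(\Gamma)$.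 Actions in $\Gamma$ are: bound actions $\mathsf{in}\,x$ (input) and $\overline{x}\langle\cdot\rangle$ (bound output) for $x<\Gamma$, and non-bound actions $\overline{x}\langle y\rangle$ (output) for $x,y<\Gamma$ and $\tau$. Set $|a|=1$ if $a$ is bound and $|a|=0$ otherwise. A renaming $\rho:\Gamma\to\Delta$ is any function $\{0,\dots,\Gamma-1\}\to\{0,\dots,\Delta-1\}$. Its lifting $\rho+1:\Gamma+1\to\Delta+1$ maps $0\mapsto0$ and $x+1\mapsto\rho(x)+1$; $\rho+n$ is the $n$-fold lifting. Renamings act on actions by renaming every name ($\rho\tau=\tau$), and on processes by: $\rho\mathbf{0}=\mathbf{0}$, $\rho(\mathsf{in}\,x.P)=\mathsf{in}\,\rho(x).((\rho+1)P)$, $\rho(\overline{x}\langle y\rangle.P)=\overline{\rho x}\langle\rho y\rangle.\rho P$, $\rho(P+Q)=\rho P+\rho Q$, $\rho(P\mid Q)=\rho P\mid\rho Q$, $\rho(\nu P)=\nu((\rho+1)P)$, $\rho(!P)=!\rho P$. Special renamings: $\mathsf{push}:\Gamma\to\Gamma+1$, $x\mapsto x+1$; for $y<\Gamma$, $\mathsf{pop}\,y:\Gamma+1\to\Gamma$, $0\mapsto y$, $x+1\mapsto x$; $\mathsf{swap}_\Gamma:\Gamma+2\to\Gamma+2$ exchanging $0$ and $1$ and fixing all $x\ge2$. Transitions: for $P\in\mathrm{Proc}(\Gamma)$, an action $a$ in $\Gamma$ and $R\in\mathrm{Proc}(\Gamma+|a|)$, the relation $P\xrightarrow{a}R$ is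 the least relation closed under the following rules ($b$ ranges over bound actions, $c$ over non-bound actions): $\mathsf{in}\,x.P\xrightarrow{\mathsf{in}\,x}P$; $\overline{x}\langle y\rangle.P\xrightarrow{\overline{x}\langle y\rangle}P$; if $P\xrightarrow{a}R$ then $P+Q\xrightarrow{a}R$; if $Q\xrightarrow{a}S$ then $P+Q\xrightarrow{a}S$; if $P\xrightarrow{c}R$ then $P\mid Q\xrightarrow{c}R\mid Q$; if $Q\xrightarrow{c}S$ then $P\mid Q\xrightarrow{c}P\mid S$; if $P\xrightarrow{b}R$ then $P\mid Q\xrightarrow{b}R\mid\mathsf{push}\,Q$; if $Q\xrightarrow{b}S$ then $P\mid Q\xrightarrow{b}\mathsf{push}\,P\mid S$; if $P\xrightarrow{\mathsf{in}\,x}R$ and $Q\xrightarrow{\overline{x}\langle y\rangle}S$ then $P\mid Q\xrightarrow{\tau}(\mathsf{pop}\,y)R\mid S$; symmetrically if $P\xrightarrow{\overline{x}\langle y\rangle}R$ and $Q\xrightarrow{\mathsf{in}\,x}S$ then $P\mid Q\xrightarrow{\tau}R\mid(\mathsf{pop}\,y)S$; if $P\xrightarrow{\overline{x+1}\langle 0\rangle}R$ then $\nu P\xrightarrow{\overline{x}\langle\cdot\rangle}R$; if $P\xrightarrow{\mathsf{in}\,x}R$ and $Q\xrightarrow{\overline{x}\langle\cdot\rangle}S$ then $P\mid Q\xrightarrow{\tau}\nu(R\mid S)$; symmetrically if $P\xrightarrow{\overline{x}\langle\cdot\rangle}R$ and $Q\xrightarrow{\mathsf{in}\,x}S$ then $P\mid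 Q\xrightarrow{\tau}\nu(R\mid S)$; if $P\xrightarrow{\mathsf{push}\,c}R$ then $\nu P\xrightarrow{c}\nu R$; if $P\xrightarrow{\mathsf{push}\,b}R$ then $\nu P\xrightarrow{b}\nu(\mathsf{swap}\,R)$; if $P\mid !P\xrightarrow{a}R$ then $!P\xrightarrow{a}R$. Generalised free braid: for $P,R\in\mathrm{Proc}(\Gamma+2+\Delta)$, $P\bowtie_\Delta R$ iff $P=(\mathsf{swap}_\Gamma+\Delta)R$. Generalised bound braid: for $P,R\in\mathrm{Proc}(\Gamma)$, $P\rtimes R$ is defined inductively by: if $P,R\in\mathrm{Proc}(\Gamma+2)$ and $P=\mathsf{swap}\,R$ then $\nu\nu P\rtimes\nu\nu R$; $\mathbf{0}\rtimes\mathbf{0}$; $\mathsf{in}\,x.P\rtimes\mathsf{in}\,x.P$; $\overline{x}\langle y\rangle.P\rtimes\overline{x}\langle y\rangle.P$; if $P\rtimes R$ then $P+Q\rtimes R+Q$; if $Q\rtimes S$ then $P+Q\rtimes P+S$; if $P\rtimes R$ and $Q\rtimes S$ then $P\mid Q\rtimes R\mid S$; if $P\rtimes R$ then $\nu P\rtimes\nu R$; if $P\rtimes R$ then $!P\rtimes !R$. A braiding between two processes is a relation of one of these two kinds. -}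

module Defs where

open import Data.Nat using (ℕ; zero; suc)
open import Data.Fin using (Fin; zero; suc)
open import Relation.Binary.PropositionalEquality using (_≡_)

-- Context extension Γ ⊹ Δ ("Γ + Δ"), by recursion on the right argument,
-- so that Γ ⊹ 1 = suc Γ and Γ ⊹ suc Δ = suc (Γ ⊹ Δ) hold definitionally.
infixl 6 _⊹_
_⊹_ : ℕ → ℕ → ℕ
Γ ⊹ zero  = Γ
Γ ⊹ suc Δ = suc (Γ ⊹ Δ)

infixr 5 _∣∣_ _⊕_
data Proc (Γ : ℕ) : Set where
  𝟘    : Proc Γ
  inp  : Fin Γ → Proc (suc Γ) → Proc Γ
  out  : Fin Γ → Fin Γ → Proc Γ → Proc Γ
  _⊕_  : Proc Γ → Proc Γ → Proc Γ
  _∣∣_ : Proc Γ → Proc Γ → Proc Γ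
  ν    : Proc (suc Γ) → Proc Γ
  !_   : Proc Γ → Proc Γ

data BAct (Γ : ℕ) : Set where
  ins  : Fin Γ → BAct Γ
  bout : Fin Γ → BAct Γ

data FAct (Γ : ℕ) : Set where
  outa : Fin Γ → Fin Γ → FAct Γ
  τ    : FAct Γ

data Action (Γ : ℕ) : Set where
  bnd : BAct Γ → Action Γ
  fre : FAct Γ → Action Γ

∣_∣ : ∀ {Γ} → Action Γ → ℕ
∣ bnd _ ∣ = 1
∣ fre _ ∣ = 0

Ren : ℕ → ℕ → Set
Ren Γ Δ = Fin Γ → Fin Δ

lift : ∀ {Γ Δ} → Ren Γ Δ → Ren (suc Γ) (suc Δ)
lift ρ zero    = zero
lift ρ (suc x) = suc (ρ x)

liftⁿ : ∀ {Γ Δ} (n : ℕ) → Ren Γ Δ → Ren (Γ ⊹ n) (Δ ⊹ n)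
liftⁿ zero    ρ = ρ
liftⁿ (suc n) ρ = lift (liftⁿ n ρ)

push : ∀ {Γ} → Ren Γ (suc Γ)
push = suc

pop : ∀ {Γ} → Fin Γ → Ren (suc Γ) Γ
pop y zero    = y
pop y (suc x) = x

swap : ∀ {Γ} → Ren (suc (suc Γ)) (suc (suc Γ))
swap zero          = suc zero
swap (suc zero)    = zero
swap (suc (suc x)) = suc (suc x)

renB : ∀ {Γ Δ} → Ren Γ Δ → BAct Γ → BAct Δ
renB ρ (ins x)  = ins (ρ x)
renB ρ (bout x) = bout (ρ x)

renF : ∀ {Γ Δ} → Ren Γ Δ → FAct Γ → FAct Δ
renF ρ (outa x y) = outa (ρ x) (ρ y)
renF ρ τ          = τ

renA : ∀ {Γ Δ} → Ren Γ Δ → Action Γ → Action Δ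
renA ρ (bnd b) = bnd (renB ρ b)
renA ρ (fre c) = fre (renF ρ c)

ren : ∀ {Γ Δ} → Ren Γ Δ → Proc Γ → Proc Δ
ren ρ 𝟘          = 𝟘
ren ρ (inp x P)   = inp (ρ x) (ren (lift ρ) P)
ren ρ (out x y P) = out (ρ x) (ρ y) (ren ρ P)
ren ρ (P ⊕ Q)     = ren ρ P ⊕ ren ρ Q
ren ρ (P ∣∣ Q)    = ren ρ P ∣∣ ren ρ Q
ren ρ (ν P)       = ν (ren (lift ρ) P)
ren ρ (! P)       = ! ren ρ P

infix 4 _—[_]→_
data _—[_]→_ {Γ : ℕ} : Proc Γ → (a : Action Γ) → Proc (Γ ⊹ ∣ a ∣) → Set where
  t-inp   : ∀ {x P} → inp x P —[ bnd (ins x) ]→ P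
  t-out   : ∀ {x y P} → out x y P —[ fre (outa x y) ]→ P
  t-sumL  : ∀ {P Q a R} → P —[ a ]→ R → (P ⊕ Q) —[ a ]→ R
  t-sumR  : ∀ {P Q a S} → Q —[ a ]→ S → (P ⊕ Q) —[ a ]→ S
  t-parLf : ∀ {P Q c R} → P —[ fre c ]→ R → (P ∣∣ Q) —[ fre c ]→ (R ∣∣ Q)
  t-parRf : ∀ {P Q c S} → Q —[ fre c ]→ S → (P ∣∣ Q) —[ fre c ]→ (P ∣∣ S)
  t-parLb : ∀ {P Q b R} → P —[ bnd b ]→ R → (P ∣∣ Q) —[ bnd b ]→ (R ∣∣ ren push Q)
  t-parRb : ∀ {P Q b S} → Q —[ bnd b ]→ S → (P ∣∣ Q) —[ bnd b ]→ (ren push P ∣∣ S)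
  t-comL  : ∀ {P Q x y R S} → P —[ bnd (ins x) ]→ R → Q —[ fre (outa x y) ]→ S →
            (P ∣∣ Q) —[ fre τ ]→ (ren (pop y) R ∣∣ S)
  t-comR  : ∀ {P Q x y R S} → P —[ fre (outa x y) ]→ R → Q —[ bnd (ins x) ]→ S →
            (P ∣∣ Q) —[ fre τ ]→ (R ∣∣ ren (pop y) S)
  t-open  : ∀ {P x R} → P —[ fre (outa (suc x) zero) ]→ R → ν P —[ bnd (bout x) ]→ R
  t-closeL : ∀ {P Q x R S} → P —[ bnd (ins x) ]→ R → Q —[ bnd (bout x) ]→ S →
             (P ∣∣ Q) —[ fre τ ]→ ν (R ∣∣ S)
  t-closeR : ∀ {P Q x R S} → P —[ bnd (bout x) ]→ R → Q —[ bnd (ins x) ]→ S →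
             (P ∣∣ Q) —[ fre τ ]→ ν (R ∣∣ S)
  t-resF  : ∀ {P c R} → P —[ fre (renF push c) ]→ R → ν P —[ fre c ]→ ν R
  t-resB  : ∀ {P b R} → P —[ bnd (renB push b) ]→ R → ν P —[ bnd b ]→ ν (ren swap R)
  t-rep   : ∀ {P a R} → (P ∣∣ ! P) —[ a ]→ R → ! P —[ a ]→ R

FreeBraid : (Γ Δ : ℕ) → Proc (Γ ⊹ 2 ⊹ Δ) → Proc (Γ ⊹ 2 ⊹ Δ) → Set
FreeBraid Γ Δ P R = P ≡ ren (liftⁿ Δ (swap {Γ})) R

-- R ⋈_{Δ+|a|} R' for R, R' : Proc (Γ+2+Δ+|a|)
-- (case split on a only to make the context Γ+2+Δ+|a| = Γ+2+(Δ+|a|) definitional)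
FreeBraidAfter : (Γ Δ : ℕ) (a : Action (Γ ⊹ 2 ⊹ Δ)) →
                 Proc (Γ ⊹ 2 ⊹ Δ ⊹ ∣ a ∣) → Proc (Γ ⊹ 2 ⊹ Δ ⊹ ∣ a ∣) → Set
FreeBraidAfter Γ Δ (bnd _) R R' = FreeBraid Γ (Δ ⊹ 1) R R'
FreeBraidAfter Γ Δ (fre _) R R' = FreeBraid Γ (Δ ⊹ 0) R R'

infix 4 _⋊_
data _⋊_ {Γ : ℕ} : Proc Γ → Proc Γ → Set where
  ⋊-νν   : ∀ (P R : Proc (suc (suc Γ))) → P ≡ ren swap R → ν (ν P) ⋊ ν (ν R)
  ⋊-𝟘    : 𝟘 ⋊ 𝟘
  ⋊-inp  : ∀ {x P} → inp x P ⋊ inp x P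
  ⋊-out  : ∀ {x y P} → out x y P ⋊ out x y P
  ⋊-sumL : ∀ {P Q R} → P ⋊ R → (P ⊕ Q) ⋊ (R ⊕ Q)
  ⋊-sumR : ∀ {P Q S} → Q ⋊ S → (P ⊕ Q) ⋊ (P ⊕ S)
  ⋊-par  : ∀ {P Q R S} → P ⋊ R → Q ⋊ S → (P ∣∣ Q) ⋊ (R ∣∣ S)
  ⋊-ν    : ∀ {P R} → P ⋊ R → ν P ⋊ ν R
  ⋊-!    : ∀ {P R} → P ⋊ R → ! P ⋊ ! R

-- Both braidings are "transparent" to the transition system.  A free braid
-- relates P to its image under the involutive renaming swap + Δ, and
-- transitions are stable under renaming.  A bound braid only exchanges two
-- adjacent ν-binders somewhere inside P; by induction on the braid, every
-- transition of P is matched by one of P' with the same action, the only real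
-- work being the four ways in which a transition can pass through ν ν.
module Submission where

open import Defs
open import Data.Nat using (ℕ)
open import Data.Fin using (Fin; zero; suc)
open import Data.Product using (Σ-syntax; ∃-syntax; _×_; _,_)
open import Function using (_∘_; id)
open import Relation.Binary.PropositionalEquality
  using (_≡_; _≗_; refl; sym; trans; cong; cong₂; subst; module ≡-Reasoning)

private variable
  Γ Δ Θ : ℕ

lift-cong : {ρ σ : Ren Γ Δ} → ρ ≗ σ → lift ρ ≗ lift σ
lift-cong ρ≗σ zero    = refl
lift-cong ρ≗σ (suc x) = cong suc (ρ≗σ x)

ren-cong : {ρ σ : Ren Γ Δ} → ρ ≗ σ → ren ρ ≗ ren σ
ren-cong ρ≗σ 𝟘           = refl
ren-cong ρ≗σ (inp x P)   = cong₂ inp (ρ≗σ x) (ren-cong (lift-cong ρ≗σ) P)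
ren-cong ρ≗σ (out x y P) = trans (cong₂ (λ u v → out u v _) (ρ≗σ x) (ρ≗σ y))
                                 (cong (out _ _) (ren-cong ρ≗σ P))
ren-cong ρ≗σ (P ⊕ Q)     = cong₂ _⊕_ (ren-cong ρ≗σ P) (ren-cong ρ≗σ Q)
ren-cong ρ≗σ (P ∣∣ Q)    = cong₂ _∣∣_ (ren-cong ρ≗σ P) (ren-cong ρ≗σ Q)
ren-cong ρ≗σ (ν P)       = cong ν (ren-cong (lift-cong ρ≗σ) P)
ren-cong ρ≗σ (! P)       = cong !_ (ren-cong ρ≗σ P)

lift-∘ : (ρ : Ren Δ Θ) (σ : Ren Γ Δ) → lift ρ ∘ lift σ ≗ lift (ρ ∘ σ)
lift-∘ ρ σ zero    = refl
lift-∘ ρ σ (suc x) = refl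

ren-∘ : (ρ : Ren Δ Θ) (σ : Ren Γ Δ) → ren ρ ∘ ren σ ≗ ren (ρ ∘ σ)
ren-∘ ρ σ 𝟘           = refl
ren-∘ ρ σ (inp x P)   = cong (inp _) (trans (ren-∘ (lift ρ) (lift σ) P) (ren-cong (lift-∘ ρ σ) P))
ren-∘ ρ σ (out x y P) = cong (out _ _) (ren-∘ ρ σ P)
ren-∘ ρ σ (P ⊕ Q)     = cong₂ _⊕_ (ren-∘ ρ σ P) (ren-∘ ρ σ Q)
ren-∘ ρ σ (P ∣∣ Q)    = cong₂ _∣∣_ (ren-∘ ρ σ P) (ren-∘ ρ σ Q)
ren-∘ ρ σ (ν P)       = cong ν (trans (ren-∘ (lift ρ) (lift σ) P) (ren-cong (lift-∘ ρ σ) P))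
ren-∘ ρ σ (! P)       = cong !_ (ren-∘ ρ σ P)

lift-id : {ρ : Ren Γ Γ} → ρ ≗ id → lift ρ ≗ id
lift-id ρ≗id zero    = refl
lift-id ρ≗id (suc x) = cong suc (ρ≗id x)

ren-id : {ρ : Ren Γ Γ} → ρ ≗ id → ren ρ ≗ id
ren-id ρ≗id 𝟘           = refl
ren-id ρ≗id (inp x P)   = cong₂ inp (ρ≗id x) (ren-id (lift-id ρ≗id) P)
ren-id ρ≗id (out x y P) = trans (cong₂ (λ u v → out u v _) (ρ≗id x) (ρ≗id y))
                                (cong (out _ _) (ren-id ρ≗id P))
ren-id ρ≗id (P ⊕ Q)     = cong₂ _⊕_ (ren-id ρ≗id P) (ren-id ρ≗id Q)
ren-id ρ≗id (P ∣∣ Q)    = cong₂ _∣∣_ (ren-id ρ≗id P) (ren-id ρ≗id Q)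
ren-id ρ≗id (ν P)       = cong ν (ren-id (lift-id ρ≗id) P)
ren-id ρ≗id (! P)       = cong !_ (ren-id ρ≗id P)

ren-commute : ∀ {Δ′} {ρ : Ren Δ Θ} {σ : Ren Γ Δ} {ρ′ : Ren Δ′ Θ} {σ′ : Ren Γ Δ′} →
              ρ ∘ σ ≗ ρ′ ∘ σ′ → ren ρ ∘ ren σ ≗ ren ρ′ ∘ ren σ′
ren-commute {ρ = ρ} {σ} {ρ′} {σ′} eq P =
  trans (ren-∘ ρ σ P) (trans (ren-cong eq P) (sym (ren-∘ ρ′ σ′ P)))

ren-involutive : {ρ : Ren Γ Γ} → ρ ∘ ρ ≗ id → ren ρ ∘ ren ρ ≗ id
ren-involutive {ρ = ρ} ρρ≗id P = trans (ren-∘ ρ ρ P) (ren-id ρρ≗id P)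

lift-involutive : {ρ : Ren Γ Γ} → ρ ∘ ρ ≗ id → lift ρ ∘ lift ρ ≗ id
lift-involutive ρρ≗id zero    = refl
lift-involutive ρρ≗id (suc x) = cong suc (ρρ≗id x)

liftⁿ-involutive : {ρ : Ren Γ Γ} (n : ℕ) → ρ ∘ ρ ≗ id → liftⁿ n ρ ∘ liftⁿ n ρ ≗ id
liftⁿ-involutive ℕ.zero    ρρ≗id = ρρ≗id
liftⁿ-involutive (ℕ.suc n) ρρ≗id = lift-involutive (liftⁿ-involutive n ρρ≗id)

swap-involutive : swap {Γ} ∘ swap ≗ id
swap-involutive zero          = refl
swap-involutive (suc zero)    = refl
swap-involutive (suc (suc x)) = refl

push-natural : (ρ : Ren Γ Δ) → lift ρ ∘ push ≗ push ∘ ρ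
push-natural ρ x = refl

pop-natural : (ρ : Ren Γ Δ) (y : Fin Γ) → pop (ρ y) ∘ lift ρ ≗ ρ ∘ pop y
pop-natural ρ y zero    = refl
pop-natural ρ y (suc x) = refl

swap-natural : (ρ : Ren Γ Δ) → swap ∘ lift (lift ρ) ≗ lift (lift ρ) ∘ swap
swap-natural ρ zero          = refl
swap-natural ρ (suc zero)    = refl
swap-natural ρ (suc (suc x)) = refl

-- The braid relation (0 1)(1 2)(0 1) = (1 2)(0 1)(1 2), rearranged using that both are involutions.
swap-braid : lift (swap {Γ}) ∘ swap ≗ swap ∘ lift swap ∘ swap ∘ lift swap
swap-braid zero                = refl
swap-braid (suc zero)          = refl
swap-braid (suc (suc zero))    = refl
swap-braid (suc (suc (suc x))) = refl

swap-braid-ren : (R : Proc (Γ ⊹ 3)) →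
                 ren (lift swap) (ren swap R) ≡ ren swap (ren (lift swap) (ren swap (ren (lift swap) R)))
swap-braid-ren R = begin
  ren (lift swap) (ren swap R)                                  ≡⟨ ren-∘ (lift swap) swap R ⟩
  ren (lift swap ∘ swap) R                                      ≡⟨ ren-cong swap-braid R ⟩
  ren (swap ∘ lift swap ∘ swap ∘ lift swap) R                   ≡⟨ ren-∘ swap _ R ⟨
  ren swap (ren (lift swap ∘ swap ∘ lift swap) R)               ≡⟨ cong (ren swap) (ren-∘ (lift swap) _ R) ⟨
  ren swap (ren (lift swap) (ren (swap ∘ lift swap) R))         ≡⟨ cong (ren swap ∘ ren (lift swap)) (ren-∘ swap (lift swap) R) ⟨
  ren swap (ren (lift swap) (ren swap (ren (lift swap) R)))     ∎
  where open ≡-Reasoning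

renResidual : (ρ : Ren Γ Δ) (a : Action Γ) → Proc (Γ ⊹ ∣ a ∣) → Proc (Δ ⊹ ∣ renA ρ a ∣)
renResidual ρ (bnd b) R = ren (lift ρ) R
renResidual ρ (fre c) R = ren ρ R

residual-cong : {P : Proc Γ} {a : Action Γ} {R R′ : Proc (Γ ⊹ ∣ a ∣)} →
                R ≡ R′ → P —[ a ]→ R → P —[ a ]→ R′
residual-cong refl P→R = P→R

—→-ren : (ρ : Ren Γ Δ) {P : Proc Γ} {a : Action Γ} {R : Proc (Γ ⊹ ∣ a ∣)} →
         P —[ a ]→ R → ren ρ P —[ renA ρ a ]→ renResidual ρ a R
—→-ren ρ t-inp              = t-inp
—→-ren ρ t-out              = t-out
—→-ren ρ (t-sumL d)         = t-sumL (—→-ren ρ d)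
—→-ren ρ (t-sumR d)         = t-sumR (—→-ren ρ d)
—→-ren ρ (t-parLf d)        = t-parLf (—→-ren ρ d)
—→-ren ρ (t-parRf d)        = t-parRf (—→-ren ρ d)
—→-ren ρ (t-parLb {Q = Q} d) =
  residual-cong (cong (_ ∣∣_) (ren-commute (push-natural ρ) Q)) (t-parLb (—→-ren ρ d))
—→-ren ρ (t-parRb {P = P} d) =
  residual-cong (cong (_∣∣ _) (ren-commute (push-natural ρ) P)) (t-parRb (—→-ren ρ d))
—→-ren ρ (t-comL {y = y} {R = R} d e) =
  residual-cong (cong (_∣∣ _) (ren-commute (pop-natural ρ y) R))
                (t-comL (—→-ren ρ d) (—→-ren ρ e))
—→-ren ρ (t-comR {y = y} {S = S} d e) =
  residual-cong (cong (_ ∣∣_) (ren-commute (pop-natural ρ y) S))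
                (t-comR (—→-ren ρ d) (—→-ren ρ e))
—→-ren ρ (t-open d)         = t-open (—→-ren (lift ρ) d)
—→-ren ρ (t-closeL d e)     = t-closeL (—→-ren ρ d) (—→-ren ρ e)
—→-ren ρ (t-closeR d e)     = t-closeR (—→-ren ρ d) (—→-ren ρ e)
-- Splitting on the action lets renA (lift ρ) ∘ renF push compute to renF push ∘ renA ρ.
—→-ren ρ (t-resF {c = outa u v} d) = t-resF (—→-ren (lift ρ) d)
—→-ren ρ (t-resF {c = τ} d)        = t-resF (—→-ren (lift ρ) d)
—→-ren ρ (t-resB {b = ins x} {R = R} d) =
  residual-cong (cong ν (ren-commute (swap-natural ρ) R)) (t-resB (—→-ren (lift ρ) d))
—→-ren ρ (t-resB {b = bout x} {R = R} d) =
  residual-cong (cong ν (ren-commute (swap-natural ρ) R)) (t-resB (—→-ren (lift ρ) d))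
—→-ren ρ (t-rep d)          = t-rep (—→-ren ρ d)

—→-ren-involutive : {ρ : Ren Γ Γ} → ρ ∘ ρ ≗ id →
                    (P : Proc Γ) {a : Action Γ} {R : Proc (Γ ⊹ ∣ a ∣)} →
                    ren ρ P —[ a ]→ R → P —[ renA ρ a ]→ renResidual ρ a R
—→-ren-involutive {ρ = ρ} ρρ≗id P {a} {R} ρP→R =
  subst (λ X → X —[ renA ρ a ]→ renResidual ρ a R) (ren-involutive ρρ≗id P) (—→-ren ρ ρP→R)

⋈-simulation :
  (Γ Δ : ℕ) (P P' : Proc (Γ ⊹ 2 ⊹ Δ)) (a : Action (Γ ⊹ 2 ⊹ Δ)) (R : Proc (Γ ⊹ 2 ⊹ Δ ⊹ ∣ a ∣)) →
  P —[ a ]→ R → FreeBraid Γ Δ P P' →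
  Σ[ a' ∈ Action (Γ ⊹ 2 ⊹ Δ) ] Σ[ e ∈ ∣ a' ∣ ≡ ∣ a ∣ ] Σ[ R' ∈ Proc (Γ ⊹ 2 ⊹ Δ ⊹ ∣ a ∣) ]
    (P' —[ a' ]→ subst (λ k → Proc (Γ ⊹ 2 ⊹ Δ ⊹ k)) (sym e) R') × FreeBraidAfter Γ Δ a R R'
⋈-simulation Γ Δ _ P' (bnd b) R P→R refl =
  _ , refl , ren (lift (liftⁿ Δ swap)) R ,
  —→-ren-involutive (liftⁿ-involutive Δ swap-involutive) P' P→R ,
  sym (ren-involutive (liftⁿ-involutive (Δ ⊹ 1) swap-involutive) R)
⋈-simulation Γ Δ _ P' (fre c) R P→R refl =
  _ , refl , ren (liftⁿ Δ swap) R ,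
  —→-ren-involutive (liftⁿ-involutive Δ swap-involutive) P' P→R ,
  sym (ren-involutive (liftⁿ-involutive Δ swap-involutive) R)

⋊-refl : (P : Proc Γ) → P ⋊ P
⋊-refl 𝟘           = ⋊-𝟘
⋊-refl (inp x P)   = ⋊-inp
⋊-refl (out x y P) = ⋊-out
⋊-refl (P ⊕ Q)     = ⋊-sumL (⋊-refl P)
⋊-refl (P ∣∣ Q)    = ⋊-par (⋊-refl P) (⋊-refl Q)
⋊-refl (ν P)       = ⋊-ν (⋊-refl P)
⋊-refl (! P)       = ⋊-! (⋊-refl P)

⋊-ren : (ρ : Ren Γ Δ) {P R : Proc Γ} → P ⋊ R → ren ρ P ⋊ ren ρ R
⋊-ren ρ (⋊-νν _ R refl) = ⋊-νν _ _ (sym (ren-commute (swap-natural ρ) R))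
⋊-ren ρ ⋊-𝟘            = ⋊-𝟘
⋊-ren ρ ⋊-inp          = ⋊-inp
⋊-ren ρ ⋊-out          = ⋊-out
⋊-ren ρ (⋊-sumL P⋊R)   = ⋊-sumL (⋊-ren ρ P⋊R)
⋊-ren ρ (⋊-sumR Q⋊S)   = ⋊-sumR (⋊-ren ρ Q⋊S)
⋊-ren ρ (⋊-par P⋊R Q⋊S) = ⋊-par (⋊-ren ρ P⋊R) (⋊-ren ρ Q⋊S)
⋊-ren ρ (⋊-ν P⋊R)      = ⋊-ν (⋊-ren (lift ρ) P⋊R)
⋊-ren ρ (⋊-! P⋊R)      = ⋊-! (⋊-ren ρ P⋊R)

⋊-Simulated : Proc Γ → (a : Action Γ) → Proc (Γ ⊹ ∣ a ∣) → Set
⋊-Simulated P′ a R = ∃[ R′ ] P′ —[ a ]→ R′ × R ⋊ R′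

νν-swap-simulation : {P : Proc (Γ ⊹ 2)} {a : Action Γ} {R : Proc (Γ ⊹ ∣ a ∣)} →
                     ν (ν P) —[ a ]→ R → ⋊-Simulated (ν (ν (ren swap P))) a R
νν-swap-simulation (t-resF {c = outa u v} (t-resF {R = R} P→R)) =
  _ , t-resF (t-resF (—→-ren swap P→R)) , ⋊-νν R _ (sym (ren-involutive swap-involutive R))
νν-swap-simulation (t-resF {c = τ} (t-resF {R = R} P→R)) =
  _ , t-resF (t-resF (—→-ren swap P→R)) , ⋊-νν R _ (sym (ren-involutive swap-involutive R))
νν-swap-simulation (t-open (t-resF {c = outa (suc x) zero} {R = R} P→R)) =
  _ , t-resB (t-open (—→-ren swap P→R)) ,
  ⋊-ν (subst (R ⋊_) (sym (ren-involutive swap-involutive R)) (⋊-refl R))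
νν-swap-simulation (t-resB {b = bout x} (t-open P→R)) =
  _ , t-open (t-resF (—→-ren swap P→R)) , ⋊-refl _
νν-swap-simulation (t-resB {b = ins x} (t-resB {R = R} P→R)) =
  _ , t-resB (t-resB (—→-ren swap P→R)) , ⋊-νν _ _ (swap-braid-ren R)
νν-swap-simulation (t-resB {b = bout x} (t-resB {R = R} P→R)) =
  _ , t-resB (t-resB (—→-ren swap P→R)) , ⋊-νν _ _ (swap-braid-ren R)

⋊-simulation : {P P′ : Proc Γ} {a : Action Γ} {R : Proc (Γ ⊹ ∣ a ∣)} →
               P —[ a ]→ R → P ⋊ P′ → ⋊-Simulated P′ a R
⋊-simulation {a = a} {R} P→R (⋊-νν _ P′ refl) =
  subst (λ X → ⋊-Simulated (ν (ν X)) a R) (ren-involutive swap-involutive P′)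
        (νν-swap-simulation P→R)
⋊-simulation ()   ⋊-𝟘
⋊-simulation P→R ⋊-inp = _ , P→R , ⋊-refl _
⋊-simulation P→R ⋊-out = _ , P→R , ⋊-refl _
⋊-simulation (t-sumL P→R) (⋊-sumL P⋊R) with ⋊-simulation P→R P⋊R
... | _ , R→ , ⋊R = _ , t-sumL R→ , ⋊R
⋊-simulation (t-sumR Q→S) (⋊-sumL _) = _ , t-sumR Q→S , ⋊-refl _
⋊-simulation (t-sumL P→R) (⋊-sumR _) = _ , t-sumL P→R , ⋊-refl _
⋊-simulation (t-sumR Q→S) (⋊-sumR Q⋊S) with ⋊-simulation Q→S Q⋊S
... | _ , S→ , ⋊S = _ , t-sumR S→ , ⋊S
⋊-simulation (t-parLf P→R) (⋊-par P⋊ Q⋊) with ⋊-simulation P→R P⋊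
... | _ , R→ , ⋊R = _ , t-parLf R→ , ⋊-par ⋊R Q⋊
⋊-simulation (t-parRf Q→S) (⋊-par P⋊ Q⋊) with ⋊-simulation Q→S Q⋊
... | _ , S→ , ⋊S = _ , t-parRf S→ , ⋊-par P⋊ ⋊S
⋊-simulation (t-parLb P→R) (⋊-par P⋊ Q⋊) with ⋊-simulation P→R P⋊
... | _ , R→ , ⋊R = _ , t-parLb R→ , ⋊-par ⋊R (⋊-ren push Q⋊)
⋊-simulation (t-parRb Q→S) (⋊-par P⋊ Q⋊) with ⋊-simulation Q→S Q⋊
... | _ , S→ , ⋊S = _ , t-parRb S→ , ⋊-par (⋊-ren push P⋊) ⋊S
⋊-simulation (t-comL {y = y} P→R Q→S) (⋊-par P⋊ Q⋊)
  with ⋊-simulation P→R P⋊ | ⋊-simulation Q→S Q⋊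
... | _ , R→ , ⋊R | _ , S→ , ⋊S = _ , t-comL R→ S→ , ⋊-par (⋊-ren (pop y) ⋊R) ⋊S
⋊-simulation (t-comR {y = y} P→R Q→S) (⋊-par P⋊ Q⋊)
  with ⋊-simulation P→R P⋊ | ⋊-simulation Q→S Q⋊
... | _ , R→ , ⋊R | _ , S→ , ⋊S = _ , t-comR R→ S→ , ⋊-par ⋊R (⋊-ren (pop y) ⋊S)
⋊-simulation (t-closeL P→R Q→S) (⋊-par P⋊ Q⋊)
  with ⋊-simulation P→R P⋊ | ⋊-simulation Q→S Q⋊
... | _ , R→ , ⋊R | _ , S→ , ⋊S = _ , t-closeL R→ S→ , ⋊-ν (⋊-par ⋊R ⋊S)
⋊-simulation (t-closeR P→R Q→S) (⋊-par P⋊ Q⋊)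
  with ⋊-simulation P→R P⋊ | ⋊-simulation Q→S Q⋊
... | _ , R→ , ⋊R | _ , S→ , ⋊S = _ , t-closeR R→ S→ , ⋊-ν (⋊-par ⋊R ⋊S)
⋊-simulation (t-open P→R) (⋊-ν P⋊) with ⋊-simulation P→R P⋊
... | _ , R→ , ⋊R = _ , t-open R→ , ⋊R
⋊-simulation (t-resF P→R) (⋊-ν P⋊) with ⋊-simulation P→R P⋊
... | _ , R→ , ⋊R = _ , t-resF R→ , ⋊-ν ⋊R
⋊-simulation (t-resB P→R) (⋊-ν P⋊) with ⋊-simulation P→R P⋊
... | _ , R→ , ⋊R = _ , t-resB R→ , ⋊-ν (⋊-ren swap ⋊R)
⋊-simulation (t-rep P∣!P→R) (⋊-! P⋊) with ⋊-simulation P∣!P→R (⋊-par P⋊ (⋊-! P⋊))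
... | _ , R→ , ⋊R = _ , t-rep R→ , ⋊R

lemma4p6 :
  ((Γ Δ : ℕ) (P P' : Proc (Γ ⊹ 2 ⊹ Δ)) (a : Action (Γ ⊹ 2 ⊹ Δ)) (R : Proc (Γ ⊹ 2 ⊹ Δ ⊹ ∣ a ∣)) →
    P —[ a ]→ R → FreeBraid Γ Δ P P' →
    Σ[ a' ∈ Action (Γ ⊹ 2 ⊹ Δ) ] Σ[ e ∈ ∣ a' ∣ ≡ ∣ a ∣ ] Σ[ R' ∈ Proc (Γ ⊹ 2 ⊹ Δ ⊹ ∣ a ∣) ]
      (P' —[ a' ]→ subst (λ k → Proc (Γ ⊹ 2 ⊹ Δ ⊹ k)) (sym e) R') × FreeBraidAfter Γ Δ a R R')
  ×
  ((n : ℕ) (P P' : Proc n) (a : Action n) (R : Proc (n ⊹ ∣ a ∣)) →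
    P —[ a ]→ R → P ⋊ P' →
    Σ[ a' ∈ Action n ] Σ[ e ∈ ∣ a' ∣ ≡ ∣ a ∣ ] Σ[ R' ∈ Proc (n ⊹ ∣ a ∣) ]
      (P' —[ a' ]→ subst (λ k → Proc (n ⊹ k)) (sym e) R') × R ⋊ R')
lemma4p6 = ⋈-simulation , λ n P P' a R P→R P⋊P' →
  let R' , P'→R' , R⋊R' = ⋊-simulation P→R P⋊P' in a , refl , R' , P'→R' , R⋊R'
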